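{- Let $B=B'(p)$, $\beta_1:=\min\{\max_{s\in S}z(s):z\in B\cap\mathbb{Z}^S\}$, $h_1(X):=p(X)-(\beta_1-1)|X|$ for $X\subseteq S$, and let $S_1$ (the peak-set of $B$) be the intersection of all subsets of $S$ maximizing $h_1$. For every pre-decreasingly-minimal (in particular every decreasingly minimal) element $m$ of $B\cap\mathbb{Z}^S$, the set $S_1(m):=\bigcup\{T_m(t):m(t)=\beta_1\}$ is independent of the choice of $m$ and $S_1(m)=S_1$.
   Context: $S$ is a finite non-empty set; $p$ is a set-function on subsets of $S$ with values in $\mathbb{Z}\cup\{ -\infty\}$, $p(\emptyset)=0$, $p(S)$ finite, and supermodular: $p(X)+p(Y)\le p(X\cap Y)+p(X\cup Y)$ whenever $p(X),p(Y)$ are finite. $B'(p)=\{x\in\mathbb{R}^S:\widetilde x(S)=p(S),\ \widetilde x(Z)\ge p(Z)\ \forall Z\subset S\}$ with $\widetilde x(Z)=\sum_{s\in Z}x(s)$. For $m\in B\cap\mathbb{Z}^S$, $X$ is $m$-tight if $\widetilde m(X)=p(X)$, and $T_m(t)$ is the intersection of all $m$-tight sets containing $t$. A vector is $\beta_1$-covered if all components are at most $\beta_1$; a $\beta_1$-covered element of $B\cap\mathbb{Z}^S$ is pre-dec-min if its number of $\beta_1$-valued components is minimum among all $\beta_1$-covered elements of $B\cap\mathbb{Z}^S$. Decreasing minimality: with $x{\downarrow}$ the decreasing rearrangement of $x$, $m$ is dec-min in $B\cap\mathbb{Z}^S$ if for every $y$ in it, $m{\downarrow}=y{\downarrow}$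 or $m{\downarrow}(j)<y{\downarrow}(j)$ at the first index $j$ where they differ. -}

module Defs where

open import Data.Nat as ℕ using (ℕ; suc)
open import Data.Integer as ℤ using (ℤ; _+_; _-_; _*_; _≤_; _<_; +_; 1ℤ)
open import Data.Integer.Properties using (≤-decTotalOrder; _≟_)
open import Data.Fin using (Fin)
open import Data.Fin.Subset using (Subset; _∈_; _∉_; _∩_; _∪_; ⊤; ⊥; ∣_∣)
open import Data.Maybe using (Maybe; just; nothing)
open import Data.List as List using (List; []; _∷_; filter; length; reverse; allFin; foldr; map)
open import Data.Product using (Σ; _×_; _,_; ∃)
open import Data.Sum using (_⊎_)
open import Relation.Binary.PropositionalEquality using (_≡_; _≢_)
open import Relation.Nullary.Decidable using (does)
import Data.List.Sort as Sort

-- ℤ ∪ {-∞}: nothing represents -∞, just a the finite value a.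
ℤ∞ : Set
ℤ∞ = Maybe ℤ

sumOver : ∀ {n} → (Fin n → ℤ) → Subset n → ℤ
sumOver {n} x Z = foldr (λ s acc → if lookup Z s then x s + acc else acc) (+ 0) (allFin n)
  where open import Data.Bool using (if_then_else_)
        open import Data.Vec using (lookup)

-- p is supermodular (in the sense of the paper: only for pairs with finite values)
Supermodular : ∀ {n} → (Subset n → ℤ∞) → Set
Supermodular {n} p = ∀ (X Y : Subset n) (a b : ℤ) → p X ≡ just a → p Y ≡ just b →
  Σ ℤ λ c → Σ ℤ λ d → p (X ∩ Y) ≡ just c × p (X ∪ Y) ≡ just d × (a + b ≤ c + d)

record Admissible {n} (p : Subset n → ℤ∞) : Set where
  field
    p-∅     : p ⊥ ≡ just (+ 0)
    p-S     : Σ ℤ λ a → p ⊤ ≡ just a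
    supermod : Supermodular p

_≥∞_ : ℤ → ℤ∞ → Set
x ≥∞ nothing = Data.Unit.⊤ where import Data.Unit
x ≥∞ just a  = a ≤ x

-- Integer points of B'(p): x̃(S) = p(S) and x̃(Z) ≥ p(Z) for all Z ⊂ S
-- (for Z = S the inequality is implied by the equality, so we quantify over all Z).
InB : ∀ {n} → (Subset n → ℤ∞) → (Fin n → ℤ) → Set
InB p x = (p ⊤ ≡ just (sumOver x ⊤)) × (∀ Z → sumOver x Z ≥∞ p Z)

IsMax : ∀ {n} → (Fin n → ℤ) → ℤ → Set
IsMax x β = (∀ s → x s ≤ β) × ∃ λ s → x s ≡ β

IsBeta1 : ∀ {n} → (Subset n → ℤ∞) → ℤ → Set
IsBeta1 p β = (Σ _ λ z → InB p z × IsMax z β) ×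
              (∀ z γ → InB p z → IsMax z γ → β ≤ γ)

h₁ : ∀ {n} → (Subset n → ℤ∞) → ℤ → Subset n → ℤ∞
h₁ p β X with p X
... | nothing = nothing
... | just a  = just (a - (β - 1ℤ) * (+ ∣ X ∣))

Maximizes : ∀ {n} → (Subset n → ℤ∞) → Subset n → Set
Maximizes f X = Σ ℤ λ a → f X ≡ just a × (∀ Y → a ≥∞ f Y)

InPeakSet : ∀ {n} → (Subset n → ℤ∞) → ℤ → Fin n → Set
InPeakSet p β u = ∀ X → Maximizes (h₁ p β) X → u ∈ X

Tight : ∀ {n} → (Subset n → ℤ∞) → (Fin n → ℤ) → Subset n → Set
Tight p m X = p X ≡ just (sumOver m X)

InT : ∀ {n} → (Subset n → ℤ∞) → (Fin n → ℤ) → Fin n → Fin n → Set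
InT p m t u = ∀ X → Tight p m X → t ∈ X → u ∈ X

InS1m : ∀ {n} → (Subset n → ℤ∞) → ℤ → (Fin n → ℤ) → Fin n → Set
InS1m p β m u = ∃ λ t → m t ≡ β × InT p m t u

Covered : ∀ {n} → ℤ → (Fin n → ℤ) → Set
Covered β x = ∀ s → x s ≤ β

countEq : ∀ {n} → ℤ → (Fin n → ℤ) → ℕ
countEq {n} β x = length (filter (λ s → x s ≟ β) (allFin n))

PreDecMin : ∀ {n} → (Subset n → ℤ∞) → ℤ → (Fin n → ℤ) → Set
PreDecMin p β m = InB p m × Covered β m ×
  (∀ y → InB p y → Covered β y → countEq β m ℕ.≤ countEq β y)

open Sort ≤-decTotalOrder using (sort)
dec↓ : ∀ {n} → (Fin n → ℤ) → List ℤ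
dec↓ {n} x = reverse (sort (map x (allFin n)))

LexLe : List ℤ → List ℤ → Set
LexLe [] []             = Data.Unit.⊤ where import Data.Unit
LexLe [] (_ ∷ _)        = Data.Empty.⊥ where import Data.Empty
LexLe (_ ∷ _) []        = Data.Empty.⊥ where import Data.Empty
LexLe (a ∷ as) (b ∷ bs) = (a < b) ⊎ (a ≡ b × LexLe as bs)

DecMin : ∀ {n} → (Subset n → ℤ∞) → (Fin n → ℤ) → Set
DecMin p m = InB p m × (∀ y → InB p y → LexLe (dec↓ m) (dec↓ y))

-- Fix β and m ∈ B ∩ ℤ^S with all m(u) ≤ β. Since p(Y) ≤ m̃(Y),
--   h₁(Y) ≤ Σ_{u∈Y} (m(u) − β + 1) ≤ #{u : m(u) = β}   for every Y,
-- the second step because each summand is at most the indicator of m(u) = β.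
-- By supermodularity the m-tight sets form a lattice, so every T_m(t) and the union
-- S₁(m) are m-tight. For pre-dec-min m every u ∈ S₁(m) has m(u) ≥ β − 1, so both
-- inequalities are equalities on S₁(m), which therefore maximises h₁. Conversely,
-- at any maximiser X both inequalities are equalities: X is m-tight and contains every
-- β-valued t, hence every T_m(t) with m(t) = β, i.e. S₁(m) ⊆ X. Finally, a dec-min
-- element is pre-dec-min: its decreasing rearrangement is lexicographically at most
-- that of any β₁-covered y, so it is β₁-covered and has no more β₁-entries than y.

module Submission where

open import Defs
open import Data.Nat as ℕ using (ℕ; zero; suc)
open import Data.Integer as ℤ using (ℤ; _+_; _-_; _*_; -_; _≤_; _<_; +_; 0ℤ; 1ℤ; -1ℤ)
import Data.Integer.Properties as ℤP
import Data.Nat.Properties as ℕP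
open import Data.Integer.Tactic.RingSolver using (solve-∀)
open import Algebra.Properties.CommutativeSemigroup ℤP.+-commutativeSemigroup using (interchange; x∙yz≈y∙xz)
open import Data.Bool using (true; false; if_then_else_)
open import Data.Fin as Fin using (Fin; zero; suc)
open import Data.Fin.Subset using (Subset; _∈_; _∉_; _∩_; _∪_; ⊤; ⊥; ∣_∣)
open import Data.Fin.Subset.Properties
  using (∈⊤; ∉⊥; x∈p∩q⁺; x∈p∩q⁻; x∈p∪q⁺; x∈p∪q⁻; _∈?_; anySubset?)
open import Data.List using (List; []; _∷_; map; filter; length; foldr; tabulate; allFin; reverse)
open import Data.List.Properties using (foldr-map; map-tabulate; unfold-reverse; filter-none)
open import Data.List.Relation.Unary.All as All using (All; []; _∷_)
import Data.List.Relation.Unary.All.Properties as AllP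
open import Data.List.Relation.Unary.AllPairs using (AllPairs; []; _∷_)
import Data.List.Relation.Unary.AllPairs.Properties as AllPairsP
open import Data.List.Relation.Unary.Linked.Properties using (Linked⇒AllPairs)
open import Data.List.Relation.Binary.Permutation.Propositional using (_↭_; ↭-sym; ↭-trans)
open import Data.List.Relation.Binary.Permutation.Propositional.Properties
  using (All-resp-↭; ↭-reverse; ↭-length; filter-↭)
open import Data.List.Sort ℤP.≤-decTotalOrder using (sort-↗; sort-↭)
open import Data.List.Membership.Propositional using () renaming (_∈_ to _∈ₗ_)
open import Data.List.Membership.Propositional.Properties using (∈-allFin)
open import Data.List.Relation.Unary.Any using (here; there)
open import Data.Maybe using (just; nothing)
open import Data.Maybe.Properties using (just-injective; ≡-dec)
open import Data.Product using (∃; _×_; _,_; proj₁; proj₂)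
open import Data.Sum using (_⊎_; inj₁; inj₂; [_,_]′; map₂)
open import Data.Unit using (tt)
open import Data.Vec using (_∷_; []; lookup; here; there)
open import Function using (_∘_; id; flip)
open import Function.Bundles using (_⇔_; mk⇔; Equivalence)
open import Relation.Binary.PropositionalEquality
open import Relation.Nullary using (¬_; Dec; yes; no; does)
open import Relation.Nullary.Decidable using (decidable-stable; _×-dec_; ¬?)
open import Relation.Nullary.Negation using (contradiction)
open import Relation.Unary using (Decidable)

≤-addˡ : ∀ {i j k} → 0ℤ ≤ k → i ≤ j → i ≤ k + j
≤-addˡ {i} 0≤k i≤j = subst (_≤ _) (ℤP.+-identityˡ i) (ℤP.+-mono-≤ 0≤k i≤j)

<-addˡ : ∀ {i j k} → 0ℤ < k → i ≤ j → i < k + j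
<-addˡ {i} 0<k i≤j = subst (_< _) (ℤP.+-identityˡ i) (ℤP.+-mono-<-≤ 0<k i≤j)

+-squeeze : ∀ {a b c d} → a ≤ c → b ≤ d → c + d ≤ a + b → a ≡ c × b ≡ d
+-squeeze {a} {b} {c} {d} a≤c b≤d c+d≤a+b =
  no-gap a≤c (λ a<c → ℤP.+-mono-<-≤ a<c b≤d) , no-gap b≤d (ℤP.+-mono-≤-< a≤c)
  where
  no-gap : ∀ {x y} → x ≤ y → (x < y → a + b < c + d) → x ≡ y
  no-gap {x} {y} x≤y gap = decidable-stable (x ℤ.≟ y)
    (λ x≢y → ℤP.<⇒≱ (gap (ℤP.≤∧≢⇒< x≤y x≢y)) c+d≤a+b)

<⇒≤-1 : ∀ {a b} → a < b → a ≤ b - 1ℤ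
<⇒≤-1 {b = b} a<b = subst (_ ≤_) (ℤP.+-comm -1ℤ b) (ℤP.i<j⇒i≤pred[j] a<b)

i-1<i : ∀ i → i - 1ℤ < i
i-1<i i = ℤP.i≤pred[j]⇒i<j (ℤP.≤-reflexive (ℤP.+-comm i -1ℤ))

<-1⇒+1< : ∀ {a b} → a < b - 1ℤ → a + 1ℤ < b
<-1⇒+1< {a} {b} a<b-1 = subst (a + 1ℤ <_) (cancel b) (ℤP.+-monoˡ-< 1ℤ a<b-1)
  where
  cancel : ∀ b → b - 1ℤ + 1ℤ ≡ b
  cancel = solve-∀

-ʳ-cancel-≤ : ∀ {i j} k → i - k ≤ j - k → i ≤ j
-ʳ-cancel-≤ {i} {j} k i-k≤j-k = subst₂ _≤_ (cancel i k) (cancel j k) (ℤP.+-monoˡ-≤ k i-k≤j-k)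
  where
  cancel : ∀ x k → x - k + k ≡ x
  cancel = solve-∀

𝟙 : ∀ {A : Set} → Dec A → ℤ
𝟙 d = if does d then 1ℤ else 0ℤ

𝟙-yes : ∀ {A : Set} (d : Dec A) → A → 𝟙 d ≡ 1ℤ
𝟙-yes (yes _) _ = refl
𝟙-yes (no ¬a) a = contradiction a ¬a

𝟙-no : ∀ {A : Set} (d : Dec A) → ¬ A → 𝟙 d ≡ 0ℤ
𝟙-no (yes a) ¬a = contradiction a ¬a
𝟙-no (no _)  _  = refl

0≤𝟙 : ∀ {A : Set} (d : Dec A) → 0ℤ ≤ 𝟙 d
0≤𝟙 (yes _) = ℤ.+≤+ ℕ.z≤n
0≤𝟙 (no _)  = ℤP.≤-refl

𝟙[_≡_] : ℤ → ℤ → ℤ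
𝟙[ a ≡ b ] = 𝟙 (a ℤ.≟ b)

sum : ∀ {n} → (Fin n → ℤ) → Subset n → ℤ
sum f []          = 0ℤ
sum f (true ∷ X)  = f zero + sum (f ∘ suc) X
sum f (false ∷ X) = sum (f ∘ suc) X

sumOver-∷ : ∀ {n} (f : Fin (suc n) → ℤ) b (X : Subset n) →
  sumOver f (b ∷ X) ≡ (if b then f zero + sumOver (f ∘ suc) X else sumOver (f ∘ suc) X)
sumOver-∷ {n} f b X = cong (step zero) (begin
  foldr step 0ℤ (tabulate suc)       ≡⟨ cong (foldr step 0ℤ) (map-tabulate id suc) ⟨
  foldr step 0ℤ (map suc (allFin n)) ≡⟨ foldr-map step suc 0ℤ (allFin n) ⟩
  sumOver (f ∘ suc) X                ∎)
  where
  open ≡-Reasoning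
  step : Fin (suc n) → ℤ → ℤ
  step s acc = if lookup (b ∷ X) s then f s + acc else acc

sumOver≡sum : ∀ {n} (f : Fin n → ℤ) X → sumOver f X ≡ sum f X
sumOver≡sum f []          = refl
sumOver≡sum f (true ∷ X)  = trans (sumOver-∷ f true X) (cong (_+_ (f zero)) (sumOver≡sum (f ∘ suc) X))
sumOver≡sum f (false ∷ X) = trans (sumOver-∷ f false X) (sumOver≡sum (f ∘ suc) X)

sum-⊥ : ∀ {n} (f : Fin n → ℤ) → sum f ⊥ ≡ 0ℤ
sum-⊥ {zero}  f = refl
sum-⊥ {suc n} f = sum-⊥ (f ∘ suc)

sum-+ : ∀ {n} (f g : Fin n → ℤ) X → sum (λ s → f s + g s) X ≡ sum f X + sum g X
sum-+ f g []          = refl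
sum-+ f g (true ∷ X)  =
  trans (cong (_+_ (f zero + g zero)) (sum-+ (f ∘ suc) (g ∘ suc) X)) (interchange (f zero) (g zero) _ _)
sum-+ f g (false ∷ X) = sum-+ (f ∘ suc) (g ∘ suc) X

sum-neg : ∀ {n} (f : Fin n → ℤ) X → sum (λ s → - f s) X ≡ - sum f X
sum-neg f []          = refl
sum-neg f (true ∷ X)  rewrite sum-neg (f ∘ suc) X = sym (ℤP.neg-distrib-+ (f zero) _)
sum-neg f (false ∷ X) = sum-neg (f ∘ suc) X

sum-minus : ∀ {n} (f g : Fin n → ℤ) X → sum (λ s → f s - g s) X ≡ sum f X - sum g X
sum-minus f g X = trans (sum-+ f (λ s → - g s) X) (cong (_+_ (sum f X)) (sum-neg g X))

sum-const : ∀ {n} (c : ℤ) (X : Subset n) → sum (λ _ → c) X ≡ c * + ∣ X ∣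
sum-const c []          = sym (ℤP.*-zeroʳ c)
sum-const c (true ∷ X)  rewrite sum-const c X = sym (begin
  c * + suc ∣ X ∣        ≡⟨ cong (c *_) (ℤP.pos-+ 1 ∣ X ∣) ⟩
  c * (1ℤ + + ∣ X ∣)     ≡⟨ ℤP.*-distribˡ-+ c 1ℤ (+ ∣ X ∣) ⟩
  c * 1ℤ + c * + ∣ X ∣   ≡⟨ cong (_+ c * + ∣ X ∣) (ℤP.*-identityʳ c) ⟩
  c + c * + ∣ X ∣        ∎)
  where open ≡-Reasoning
sum-const c (false ∷ X) = sum-const c X

sum-shift : ∀ {n} (f : Fin n → ℤ) (c : ℤ) X → sum (λ s → f s - c) X ≡ sum f X - c * + ∣ X ∣
sum-shift f c X = trans (sum-minus f (λ _ → c) X) (cong (λ z → sum f X - z) (sum-const c X))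

sum-cong : ∀ {n} {f g : Fin n → ℤ} X → (∀ {u} → u ∈ X → f u ≡ g u) → sum f X ≡ sum g X
sum-cong []          f≗g = refl
sum-cong (true ∷ X)  f≗g = cong₂ _+_ (f≗g here) (sum-cong X (f≗g ∘ there))
sum-cong (false ∷ X) f≗g = sum-cong X (f≗g ∘ there)

sum-mono-≤ : ∀ {n} {f g : Fin n → ℤ} X → (∀ s → f s ≤ g s) → sum f X ≤ sum g X
sum-mono-≤ []          f≤g = ℤP.≤-refl
sum-mono-≤ (true ∷ X)  f≤g = ℤP.+-mono-≤ (f≤g zero) (sum-mono-≤ X (f≤g ∘ suc))
sum-mono-≤ (false ∷ X) f≤g = sum-mono-≤ X (f≤g ∘ suc)

sum-mono-< : ∀ {n} {f g : Fin n → ℤ} {t} X → (∀ s → f s ≤ g s) → t ∈ X → f t < g t → sum f X < sum g X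
sum-mono-< (true ∷ X) f≤g here       ft<gt = ℤP.+-mono-<-≤ ft<gt (sum-mono-≤ X (f≤g ∘ suc))
sum-mono-< (true ∷ X) f≤g (there t∈) ft<gt = ℤP.+-mono-≤-< (f≤g zero) (sum-mono-< X (f≤g ∘ suc) t∈ ft<gt)
sum-mono-< (false ∷ X) f≤g (there t∈) ft<gt = sum-mono-< X (f≤g ∘ suc) t∈ ft<gt

sum-∩-∪ : ∀ {n} (f : Fin n → ℤ) X Y → sum f (X ∩ Y) + sum f (X ∪ Y) ≡ sum f X + sum f Y
sum-∩-∪ f []          []          = refl
sum-∩-∪ f (true ∷ X)  (true ∷ Y)  = trans (interchange (f zero) _ (f zero) _)
  (trans (cong (_+_ (f zero + f zero)) (sum-∩-∪ (f ∘ suc) X Y)) (interchange (f zero) (f zero) _ _))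
sum-∩-∪ f (true ∷ X)  (false ∷ Y) = trans (x∙yz≈y∙xz (sum (f ∘ suc) (X ∩ Y)) (f zero) _)
  (trans (cong (_+_ (f zero)) (sum-∩-∪ (f ∘ suc) X Y)) (sym (ℤP.+-assoc (f zero) _ _)))
sum-∩-∪ f (false ∷ X) (true ∷ Y)  = trans (x∙yz≈y∙xz (sum (f ∘ suc) (X ∩ Y)) (f zero) _)
  (trans (cong (_+_ (f zero)) (sum-∩-∪ (f ∘ suc) X Y)) (x∙yz≈y∙xz (f zero) (sum (f ∘ suc) X) _))
sum-∩-∪ f (false ∷ X) (false ∷ Y) = sum-∩-∪ (f ∘ suc) X Y

sum-0 : ∀ {n} (X : Subset n) → sum (λ _ → 0ℤ) X ≡ 0ℤ
sum-0 X = trans (sum-const 0ℤ X) (ℤP.*-zeroˡ (+ ∣ X ∣))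

sum≤sum⊤ : ∀ {n} {f : Fin n → ℤ} → (∀ s → 0ℤ ≤ f s) → ∀ X → sum f X ≤ sum f ⊤
sum≤sum⊤         f≥0 []          = ℤP.≤-refl
sum≤sum⊤ {f = f} f≥0 (true ∷ X)  = ℤP.+-monoʳ-≤ (f zero) (sum≤sum⊤ (f≥0 ∘ suc) X)
sum≤sum⊤         f≥0 (false ∷ X) = ≤-addˡ (f≥0 zero) (sum≤sum⊤ (f≥0 ∘ suc) X)

sum<sum⊤ : ∀ {n} {f : Fin n → ℤ} {t} → (∀ s → 0ℤ ≤ f s) → ∀ X → t ∉ X → 0ℤ < f t → sum f X < sum f ⊤
sum<sum⊤ {t = zero}  f≥0 (true ∷ X)  t∉X ft>0 = contradiction here t∉X
sum<sum⊤ {t = zero}  f≥0 (false ∷ X) t∉X ft>0 = <-addˡ ft>0 (sum≤sum⊤ (f≥0 ∘ suc) X)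
sum<sum⊤ {f = f} {suc t} f≥0 (true ∷ X)  t∉X ft>0 =
  ℤP.+-monoʳ-< (f zero) (sum<sum⊤ (f≥0 ∘ suc) X (t∉X ∘ there) ft>0)
sum<sum⊤ {f = f} {suc t} f≥0 (false ∷ X) t∉X ft>0 =
  ℤP.<-≤-trans (sum<sum⊤ (f≥0 ∘ suc) X (t∉X ∘ there) ft>0) (≤-addˡ (f≥0 zero) ℤP.≤-refl)

sum≡sum⊤ : ∀ {n} {f : Fin n → ℤ} X → (∀ {u} → u ∉ X → f u ≡ 0ℤ) → sum f X ≡ sum f ⊤
sum≡sum⊤         []          f-supp = refl
sum≡sum⊤ {f = f} (true ∷ X)  f-supp =
  cong (_+_ (f zero)) (sum≡sum⊤ X (λ u∉X → f-supp (λ { (there u∈X) → u∉X u∈X })))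
sum≡sum⊤ {f = f} (false ∷ X) f-supp = begin
  sum (f ∘ suc) X            ≡⟨ sum≡sum⊤ X (λ u∉X → f-supp (λ { (there u∈X) → u∉X u∈X })) ⟩
  sum (f ∘ suc) ⊤            ≡⟨ ℤP.+-identityˡ _ ⟨
  0ℤ + sum (f ∘ suc) ⊤       ≡⟨ cong (_+ sum (f ∘ suc) ⊤) (f-supp (λ ())) ⟨
  f zero + sum (f ∘ suc) ⊤   ∎
  where open ≡-Reasoning

δ : ∀ {n} → Fin n → Fin n → ℤ
δ t u = 𝟙 (t Fin.≟ u)

sum-δ-∈ : ∀ {n} {t : Fin n} X → t ∈ X → sum (δ t) X ≡ 1ℤ
sum-δ-∈ {t = zero}  (true ∷ X) here = cong (_+_ 1ℤ) (sum-0 X)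
sum-δ-∈ {t = suc t} (true ∷ X)  (there t∈X) = trans (ℤP.+-identityˡ _) (sum-δ-∈ X t∈X)
sum-δ-∈ {t = suc t} (false ∷ X) (there t∈X) = sum-δ-∈ X t∈X

sum-δ-∉ : ∀ {n} {t : Fin n} X → t ∉ X → sum (δ t) X ≡ 0ℤ
sum-δ-∉ []                           t∉X = refl
sum-δ-∉ {t = zero}  (true ∷ X)  t∉X = contradiction here t∉X
sum-δ-∉ {t = zero}  (false ∷ X) t∉X = sum-0 X
sum-δ-∉ {t = suc t} (true ∷ X)  t∉X = trans (ℤP.+-identityˡ _) (sum-δ-∉ X (t∉X ∘ there))
sum-δ-∉ {t = suc t} (false ∷ X) t∉X = sum-δ-∉ X (t∉X ∘ there)

length-filter-map : ∀ {A B : Set} {P : B → Set} (P? : Decidable P) (f : A → B) xs →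
  length (filter P? (map f xs)) ≡ length (filter (P? ∘ f) xs)
length-filter-map P? f []       = refl
length-filter-map P? f (x ∷ xs) with does (P? (f x))
... | true  = cong suc (length-filter-map P? f xs)
... | false = length-filter-map P? f xs

countEq-tail : ∀ {n} β (x : Fin (suc n) → ℤ) →
  length (filter (λ s → x s ℤ.≟ β) (tabulate suc)) ≡ countEq β (x ∘ suc)
countEq-tail {n} β x = trans (cong (length ∘ filter (λ s → x s ℤ.≟ β)) (sym (map-tabulate id suc)))
  (length-filter-map (λ s → x s ℤ.≟ β) suc (allFin n))

countEq≡sum : ∀ {n} β (x : Fin n → ℤ) → + countEq β x ≡ sum (λ s → 𝟙[ x s ≡ β ]) ⊤
countEq≡sum {zero}  β x = refl
countEq≡sum {suc n} β x with does (x zero ℤ.≟ β)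
... | true  = trans (ℤP.pos-+ 1 _)
                (cong (_+_ 1ℤ) (trans (cong +_ (countEq-tail β x)) (countEq≡sum β (x ∘ suc))))
... | false = trans (cong +_ (countEq-tail β x))
                (trans (countEq≡sum β (x ∘ suc)) (sym (ℤP.+-identityˡ _)))

-- Finite intersections and unions inside a family of subsets

module _ {n} (C : Subset n → Set) where

  ⋂-separating : C ⊤ → (∀ {X Y} → C X → C Y → C (X ∩ Y)) → {Q : Fin n → Set} →
    (∀ u → Q u ⊎ ∃ λ Z → C Z × u ∉ Z) → ∃ λ W → C W × (∀ {u} → u ∈ W → Q u)
  ⋂-separating C⊤ C∩ {Q} Q-or-separated =
    let W , CW , W⊆Q = go (allFin n) in W , CW , λ {u} → W⊆Q (∈-allFin u)
    where
    go : (L : List (Fin n)) → ∃ λ W → C W × (∀ {u} → u ∈ₗ L → u ∈ W → Q u)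
    go []      = ⊤ , C⊤ , λ ()
    go (v ∷ L) with go L | Q-or-separated v
    ... | W , CW , W⊆Q | inj₁ Qv = W , CW , λ { (here refl) _ → Qv ; (there u∈L) → W⊆Q u∈L }
    ... | W , CW , W⊆Q | inj₂ (Z , CZ , v∉Z) = W ∩ Z , C∩ CW CZ , λ
      { (here refl) u∈W∩Z → contradiction (proj₂ (x∈p∩q⁻ W Z u∈W∩Z)) v∉Z
      ; (there u∈L) u∈W∩Z → W⊆Q u∈L (proj₁ (x∈p∩q⁻ W Z u∈W∩Z)) }

  ⋃-covering : C ⊥ → (∀ {X Y} → C X → C Y → C (X ∪ Y)) → {P R : Fin n → Set} → Decidable P →
    (∀ {t} → P t → ∃ λ Z → C Z × t ∈ Z × (∀ {u} → u ∈ Z → R u)) →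
    ∃ λ Z → C Z × (∀ {t} → P t → t ∈ Z) × (∀ {u} → u ∈ Z → R u)
  ⋃-covering C⊥ C∪ {P} {R} P? cover =
    let Z , CZ , P⊆Z , Z⊆R = go (allFin n) in Z , CZ , (λ {t} → P⊆Z (∈-allFin t)) , Z⊆R
    where
    go : (L : List (Fin n)) →
      ∃ λ Z → C Z × (∀ {t} → t ∈ₗ L → P t → t ∈ Z) × (∀ {u} → u ∈ Z → R u)
    go []      = ⊥ , C⊥ , (λ ()) , λ u∈⊥ → contradiction u∈⊥ ∉⊥
    go (t ∷ L) with go L | P? t
    ... | Z , CZ , P⊆Z , Z⊆R | no ¬Pt =
      Z , CZ , (λ { (here refl) Pt → contradiction Pt ¬Pt ; (there t∈L) → P⊆Z t∈L }) , Z⊆R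
    ... | Z , CZ , P⊆Z , Z⊆R | yes Pt with cover Pt
    ...   | W , CW , t∈W , W⊆R = Z ∪ W , C∪ CZ CW ,
      (λ { (here refl) _ → x∈p∪q⁺ (inj₂ t∈W) ; (there t∈L) Pt → x∈p∪q⁺ (inj₁ (P⊆Z t∈L Pt)) }) ,
      λ {u} u∈Z∪W → [ Z⊆R , W⊆R ]′ (x∈p∪q⁻ Z W u∈Z∪W)

-- Moving one unit between two components

transfer : ∀ {n} → Fin n → Fin n → (Fin n → ℤ) → Fin n → ℤ
transfer s t x u = x u + δ s u - δ t u

sum-transfer : ∀ {n} s t (x : Fin n → ℤ) X → sum (transfer s t x) X ≡ sum x X + sum (δ s) X - sum (δ t) X
sum-transfer s t x X =
  trans (sum-minus (λ u → x u + δ s u) (δ t) X) (cong (_- sum (δ t) X) (sum-+ x (δ s) X))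

sum-transfer-⊤ : ∀ {n} s t (x : Fin n → ℤ) → sum (transfer s t x) ⊤ ≡ sum x ⊤
sum-transfer-⊤ s t x = begin
  sum (transfer s t x) ⊤                ≡⟨ sum-transfer s t x ⊤ ⟩
  sum x ⊤ + sum (δ s) ⊤ - sum (δ t) ⊤   ≡⟨ cong₂ (λ i j → sum x ⊤ + i - j) Σδs Σδt ⟩
  sum x ⊤ + 1ℤ - 1ℤ                     ≡⟨ cancel (sum x ⊤) ⟩
  sum x ⊤                               ∎
  where
  open ≡-Reasoning
  cancel : ∀ y → y + 1ℤ - 1ℤ ≡ y
  cancel = solve-∀

  Σδs : sum (δ s) ⊤ ≡ 1ℤ
  Σδs = sum-δ-∈ {t = s} ⊤ ∈⊤

  Σδt : sum (δ t) ⊤ ≡ 1ℤ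
  Σδt = sum-δ-∈ {t = t} ⊤ ∈⊤

sum-transfer-≥ : ∀ {n} {s t : Fin n} (x : Fin n → ℤ) Z {a} →
  a ≤ sum x Z → (t ∈ Z → s ∉ Z → a < sum x Z) → a ≤ sum (transfer s t x) Z
sum-transfer-≥ {s = s} {t} x Z {a} a≤ t-only⇒a< =
  subst (a ≤_) (sym (sum-transfer s t x Z)) (by-cases (t ∈? Z) (s ∈? Z))
  where
  y : ℤ
  y = sum x Z

  by-cases : Dec (t ∈ Z) → Dec (s ∈ Z) → a ≤ y + sum (δ s) Z - sum (δ t) Z
  by-cases (yes t∈Z) (yes s∈Z) rewrite sum-δ-∈ Z s∈Z | sum-δ-∈ Z t∈Z = subst (a ≤_) (both y) a≤
    where
    both : ∀ y → y ≡ y + 1ℤ - 1ℤ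
    both = solve-∀
  by-cases (yes t∈Z) (no s∉Z)  rewrite sum-δ-∉ Z s∉Z | sum-δ-∈ Z t∈Z =
    subst (a ≤_) (target-only y) (<⇒≤-1 (t-only⇒a< t∈Z s∉Z))
    where
    target-only : ∀ y → y - 1ℤ ≡ y + 0ℤ - 1ℤ
    target-only = solve-∀
  by-cases (no t∉Z)  (yes s∈Z) rewrite sum-δ-∈ Z s∈Z | sum-δ-∉ Z t∉Z =
    subst (a ≤_) (source-only y) (≤-addˡ (ℤ.+≤+ ℕ.z≤n) a≤)
    where
    source-only : ∀ y → 1ℤ + y ≡ y + 1ℤ - 0ℤ
    source-only = solve-∀
  by-cases (no t∉Z)  (no s∉Z)  rewrite sum-δ-∉ Z s∉Z | sum-δ-∉ Z t∉Z = subst (a ≤_) (neither y) a≤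
    where
    neither : ∀ y → y ≡ y + 0ℤ - 0ℤ
    neither = solve-∀

transfer-source : ∀ {n} {s t : Fin n} (x : Fin n → ℤ) → s ≢ t → transfer s t x s ≡ x s + 1ℤ
transfer-source {s = s} {t} x s≢t =
  trans (cong₂ (λ i j → x s + i - j) (𝟙-yes (s Fin.≟ s) refl) (𝟙-no (t Fin.≟ s) (s≢t ∘ sym)))
        (ℤP.+-identityʳ _)

transfer-target : ∀ {n} {s t : Fin n} (x : Fin n → ℤ) → s ≢ t → transfer s t x t ≡ x t - 1ℤ
transfer-target {s = s} {t} x s≢t =
  trans (cong₂ (λ i j → x t + i - j) (𝟙-no (s Fin.≟ t) s≢t) (𝟙-yes (t Fin.≟ t) refl))
        (cong (_- 1ℤ) (ℤP.+-identityʳ (x t)))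

transfer-other : ∀ {n} {s t u : Fin n} (x : Fin n → ℤ) → u ≢ s → u ≢ t → transfer s t x u ≡ x u
transfer-other {s = s} {t} {u} x u≢s u≢t =
  trans (cong₂ (λ i j → x u + i - j) (𝟙-no (s Fin.≟ u) (u≢s ∘ sym)) (𝟙-no (t Fin.≟ u) (u≢t ∘ sym)))
        (trans (ℤP.+-identityʳ _) (ℤP.+-identityʳ (x u)))

below⇒≢ : ∀ {n β} {x : Fin n → ℤ} {s t} → x t ≡ β → x s + 1ℤ < β → s ≢ t
below⇒≢ {x = x} {s} xt≡β xs+1<β s≡t =
  ℤP.<-irrefl (trans (cong x s≡t) xt≡β) (ℤP.≤-<-trans (ℤP.i≤i+j (x s) 1ℤ) xs+1<β)

transfer-covered : ∀ {n β} {x : Fin n → ℤ} {s t} →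
  Covered β x → x t ≡ β → x s + 1ℤ < β → Covered β (transfer s t x)
transfer-covered {x = x} {s} {t} x≤β xt≡β xs+1<β u = by-cases (u Fin.≟ s) (u Fin.≟ t)
  where
  s≢t : s ≢ t
  s≢t = below⇒≢ {x = x} xt≡β xs+1<β

  by-cases : Dec (u ≡ s) → Dec (u ≡ t) → transfer s t x u ≤ _
  by-cases (yes refl) _          = subst (_≤ _) (sym (transfer-source x s≢t)) (ℤP.<⇒≤ xs+1<β)
  by-cases (no _)     (yes refl) = subst (_≤ _) (sym (transfer-target x s≢t))
                                         (ℤP.<⇒≤ (ℤP.<-≤-trans (i-1<i (x t)) (x≤β t)))
  by-cases (no u≢s)   (no u≢t)   = subst (_≤ _) (sym (transfer-other x u≢s u≢t)) (x≤β u)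

countEq-transfer : ∀ {n β} {x : Fin n → ℤ} {s t} →
  x t ≡ β → x s + 1ℤ < β → countEq β (transfer s t x) ℕ.< countEq β x
countEq-transfer {β = β} {x} {s} {t} xt≡β xs+1<β =
  ℤP.drop‿+<+ (subst₂ _<_ (sym (countEq≡sum β (transfer s t x))) (sym (countEq≡sum β x))
    (sum-mono-< ⊤ fewer ∈⊤ lost-at-t))
  where
  s≢t : s ≢ t
  s≢t = below⇒≢ {x = x} xt≡β xs+1<β

  x′t≢β : transfer s t x t ≢ β
  x′t≢β eq =
    ℤP.<-irrefl (trans (sym (trans (transfer-target x s≢t) (cong (_- 1ℤ) xt≡β))) eq) (i-1<i β)

  lost-at-t : 𝟙[ transfer s t x t ≡ β ] < 𝟙[ x t ≡ β ]
  lost-at-t = subst₂ _<_ (sym (𝟙-no (_ ℤ.≟ β) x′t≢β)) (sym (𝟙-yes (x t ℤ.≟ β) xt≡β))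
                         (ℤ.+<+ (ℕ.s≤s ℕ.z≤n))

  x′s≢β : transfer s t x s ≢ β
  x′s≢β eq = ℤP.<-irrefl (trans (sym (transfer-source x s≢t)) eq) xs+1<β

  fewer : ∀ u → 𝟙[ transfer s t x u ≡ β ] ≤ 𝟙[ x u ≡ β ]
  fewer u = by-cases (u Fin.≟ s) (u Fin.≟ t)
    where
    by-cases : Dec (u ≡ s) → Dec (u ≡ t) → 𝟙[ transfer s t x u ≡ β ] ≤ 𝟙[ x u ≡ β ]
    by-cases (yes refl) _          = subst (_≤ _) (sym (𝟙-no (_ ℤ.≟ β) x′s≢β)) (0≤𝟙 (x s ℤ.≟ β))
    by-cases (no _)     (yes refl) = ℤP.<⇒≤ lost-at-t
    by-cases (no u≢s)   (no u≢t)   = ℤP.≤-reflexive (cong 𝟙[_≡ β ] (transfer-other x u≢s u≢t))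

-- Tight sets

module TightSets {n} {p : Subset n → ℤ∞} (adm : Admissible p) {m : Fin n → ℤ} (m∈B : InB p m) where
  open Admissible adm

  lower-bound : ∀ {X a} → p X ≡ just a → a ≤ sum m X
  lower-bound {X} {a} pX≡a =
    subst (a ≤_) (sumOver≡sum m X) (subst (sumOver m X ≥∞_) pX≡a (proj₂ m∈B X))

  tight⇒ : ∀ {X} → Tight p m X → p X ≡ just (sum m X)
  tight⇒ {X} tX = trans tX (cong just (sumOver≡sum m X))

  ⇒tight : ∀ {X} → p X ≡ just (sum m X) → Tight p m X
  ⇒tight {X} eq = trans eq (cong just (sym (sumOver≡sum m X)))

  ⊤-tight : Tight p m ⊤
  ⊤-tight = proj₁ m∈B

  ⊥-tight : Tight p m ⊥
  ⊥-tight = ⇒tight (trans p-∅ (cong just (sym (sum-⊥ m))))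

  ∩-∪-tight : ∀ {X Y} → Tight p m X → Tight p m Y → Tight p m (X ∩ Y) × Tight p m (X ∪ Y)
  ∩-∪-tight {X} {Y} tX tY with supermod X Y _ _ (tight⇒ tX) (tight⇒ tY)
  ... | c , d , pX∩Y≡c , pX∪Y≡d , sum≤c+d
    with +-squeeze (lower-bound pX∩Y≡c) (lower-bound pX∪Y≡d)
                   (subst (_≤ c + d) (sym (sum-∩-∪ m X Y)) sum≤c+d)
  ...   | c≡ , d≡ = ⇒tight (trans pX∩Y≡c (cong just c≡)) , ⇒tight (trans pX∪Y≡d (cong just d≡))

  tight? : Decidable (Tight p m)
  tight? X = ≡-dec ℤ._≟_ (p X) (just (sumOver m X))

  InT-or-separated : ∀ t u → InT p m t u ⊎ ∃ λ Z → Tight p m Z × t ∈ Z × u ∉ Z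
  InT-or-separated t u with anySubset? (λ Z → tight? Z ×-dec t ∈? Z ×-dec ¬? (u ∈? Z))
  ... | yes separated = inj₂ separated
  ... | no ¬separated = inj₁ λ X tX t∈X →
    decidable-stable (u ∈? X) (λ u∉X → ¬separated (X , tX , t∈X , u∉X))

  T-tight : ∀ t → ∃ λ W → Tight p m W × t ∈ W × (∀ {u} → u ∈ W → InT p m t u)
  T-tight t =
    let W , (tW , t∈W) , W⊆T = ⋂-separating (λ Z → Tight p m Z × t ∈ Z) (⊤-tight , ∈⊤)
          (λ (tX , t∈X) (tY , t∈Y) → proj₁ (∩-∪-tight tX tY) , x∈p∩q⁺ (t∈X , t∈Y))
          (λ u → map₂ (λ (Z , tZ , t∈Z , u∉Z) → Z , (tZ , t∈Z) , u∉Z) (InT-or-separated t u))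
    in W , tW , t∈W , W⊆T

  S₁m-is-tight : ∀ β → ∃ λ Z → Tight p m Z × (∀ {u} → u ∈ Z ⇔ InS1m p β m u)
  S₁m-is-tight β =
    let Z , tZ , βs⊆Z , Z⊆S₁ = ⋃-covering (Tight p m) ⊥-tight (λ tX tY → proj₂ (∩-∪-tight tX tY))
          (λ t → m t ℤ.≟ β)
          (λ {t} mt≡β → let W , tW , t∈W , W⊆T = T-tight t in W , tW , t∈W , λ u∈W → t , mt≡β , W⊆T u∈W)
    in Z , tZ , mk⇔ Z⊆S₁ (λ (t , mt≡β , u∈Tt) → u∈Tt Z tZ (βs⊆Z mt≡β))

  transfer-InB : ∀ {s t} → InT p m t s → InB p (transfer s t m)
  transfer-InB {s} {t} s∈Tt = total , bound
    where
    total : p ⊤ ≡ just (sumOver (transfer s t m) ⊤)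
    total = trans (tight⇒ ⊤-tight)
      (cong just (sym (trans (sumOver≡sum (transfer s t m) ⊤) (sum-transfer-⊤ s t m))))

    bound : ∀ Z → sumOver (transfer s t m) Z ≥∞ p Z
    bound Z with p Z in pZ≡a
    ... | nothing = tt
    ... | just a  = subst (a ≤_) (sym (sumOver≡sum (transfer s t m) Z))
                      (sum-transfer-≥ m Z (lower-bound pZ≡a) Z-not-tight)
      where
      Z-not-tight : t ∈ Z → s ∉ Z → a < sum m Z
      Z-not-tight t∈Z s∉Z = ℤP.≤∧≢⇒< (lower-bound pZ≡a)
        λ a≡ → s∉Z (s∈Tt Z (⇒tight (trans pZ≡a (cong just a≡))) t∈Z)

-- The peak set

h₁-just : ∀ {n} {p : Subset n → ℤ∞} {β X a} → p X ≡ just a → h₁ p β X ≡ just (a - (β - 1ℤ) * + ∣ X ∣)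
h₁-just pX≡a rewrite pX≡a = refl

h₁-finite : ∀ {n} {p : Subset n → ℤ∞} {β X v} → h₁ p β X ≡ just v →
  ∃ λ a → p X ≡ just a × v ≡ a - (β - 1ℤ) * + ∣ X ∣
h₁-finite {p = p} {X = X} h₁X≡v with p X
h₁-finite h₁X≡v | just a = a , refl , sym (just-injective h₁X≡v)

module PreDecMinimal {n} {p : Subset n → ℤ∞} (adm : Admissible p) {β : ℤ} {m : Fin n → ℤ}
                     (m-pdm : PreDecMin p β m) where
  open TightSets adm {m} (proj₁ m-pdm)
  private
    m≤β : Covered β m
    m≤β = proj₁ (proj₂ m-pdm)

    fewest-β : ∀ y → InB p y → Covered β y → countEq β m ℕ.≤ countEq β y
    fewest-β = proj₂ (proj₂ m-pdm)

  -- Otherwise moving one unit from t to u keeps m in B (u ∈ T_m(t)) and β-covered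
  -- while losing a β-valued component.
  S₁m-above-β-1 : ∀ {u} → InS1m p β m u → β - 1ℤ ≤ m u
  S₁m-above-β-1 {u} (t , mt≡β , u∈Tt) = decidable-stable ((β - 1ℤ) ℤP.≤? m u) λ mu≱β-1 →
    let mu+1<β = <-1⇒+1< (ℤP.≰⇒> mu≱β-1) in
    ℕP.<⇒≱ (countEq-transfer {x = m} mt≡β mu+1<β)
           (fewest-β (transfer u t m) (transfer-InB u∈Tt) (transfer-covered {x = m} m≤β mt≡β mu+1<β))

  excess : Fin n → ℤ
  excess u = m u - (β - 1ℤ)

  private
    β-[β-1] : ∀ β → β - (β - 1ℤ) ≡ 1ℤ
    β-[β-1] = solve-∀

  excess≤𝟙 : ∀ u → excess u ≤ 𝟙[ m u ≡ β ]
  excess≤𝟙 u with m u ℤ.≟ β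
  ... | yes mu≡β = ℤP.≤-reflexive (trans (cong (_- (β - 1ℤ)) mu≡β) (β-[β-1] β))
  ... | no  mu≢β = ℤP.i≤j⇒i-j≤0 (<⇒≤-1 (ℤP.≤∧≢⇒< (m≤β u) mu≢β))

  excess≡𝟙 : ∀ {u} → β - 1ℤ ≤ m u → excess u ≡ 𝟙[ m u ≡ β ]
  excess≡𝟙 {u} β-1≤mu with m u ℤ.≟ β
  ... | yes mu≡β = trans (cong (_- (β - 1ℤ)) mu≡β) (β-[β-1] β)
  ... | no  mu≢β = trans (cong (_- (β - 1ℤ)) mu≡β-1) (ℤP.+-inverseʳ (β - 1ℤ))
    where
    mu≡β-1 : m u ≡ β - 1ℤ
    mu≡β-1 = ℤP.≤-antisym (<⇒≤-1 (ℤP.≤∧≢⇒< (m≤β u) mu≢β)) β-1≤mu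

  #β : ℤ
  #β = sum (λ u → 𝟙[ m u ≡ β ]) ⊤

  h₁≤sum-excess : ∀ {Y a} → p Y ≡ just a → a - (β - 1ℤ) * + ∣ Y ∣ ≤ sum excess Y
  h₁≤sum-excess {Y} pY≡a =
    subst (_ ≤_) (sym (sum-shift m (β - 1ℤ) Y)) (ℤP.+-monoˡ-≤ _ (lower-bound pY≡a))

  sum-excess≤#β : ∀ Y → sum excess Y ≤ #β
  sum-excess≤#β Y = ℤP.≤-trans (sum-mono-≤ Y excess≤𝟙) (sum≤sum⊤ (λ u → 0≤𝟙 (m u ℤ.≟ β)) Y)

  S₁ : Subset n
  S₁ = proj₁ (S₁m-is-tight β)

  S₁-tight : Tight p m S₁
  S₁-tight = proj₁ (proj₂ (S₁m-is-tight β))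

  ∈S₁⇔ : ∀ {u} → u ∈ S₁ ⇔ InS1m p β m u
  ∈S₁⇔ = proj₂ (proj₂ (S₁m-is-tight β))

  h₁-S₁ : h₁ p β S₁ ≡ just #β
  h₁-S₁ = trans (h₁-just {p = p} (tight⇒ S₁-tight)) (cong just (begin
    sum m S₁ - (β - 1ℤ) * + ∣ S₁ ∣   ≡⟨ sum-shift m (β - 1ℤ) S₁ ⟨
    sum excess S₁                    ≡⟨ sum-cong S₁ (excess≡𝟙 ∘ S₁m-above-β-1 ∘ Equivalence.to ∈S₁⇔) ⟩
    sum (λ u → 𝟙[ m u ≡ β ]) S₁      ≡⟨ sum≡sum⊤ S₁ off-S₁ ⟩
    #β                               ∎))
    where
    open ≡-Reasoning
    β-valued∈S₁ : ∀ {u} → m u ≡ β → u ∈ S₁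
    β-valued∈S₁ {u} mu≡β = Equivalence.from ∈S₁⇔ (u , mu≡β , λ _ _ u∈X → u∈X)

    off-S₁ : ∀ {u} → u ∉ S₁ → 𝟙[ m u ≡ β ] ≡ 0ℤ
    off-S₁ {u} u∉S₁ = 𝟙-no (m u ℤ.≟ β) (u∉S₁ ∘ β-valued∈S₁)

  S₁-maximizes : Maximizes (h₁ p β) S₁
  S₁-maximizes = #β , h₁-S₁ , bound
    where
    bound : ∀ Y → #β ≥∞ h₁ p β Y
    bound Y with h₁ p β Y in h₁Y≡v
    ... | nothing = tt
    ... | just v  with h₁-finite {p = p} {X = Y} h₁Y≡v
    ...   | a , pY≡a , refl = ℤP.≤-trans (h₁≤sum-excess pY≡a) (sum-excess≤#β Y)

  maximizer⊇S₁m : ∀ {X} → Maximizes (h₁ p β) X → ∀ {u} → InS1m p β m u → u ∈ X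
  maximizer⊇S₁m {X} (v , h₁X≡v , v-max) (t , mt≡β , u∈Tt) with h₁-finite {p = p} {X = X} h₁X≡v
  ... | a , pX≡a , refl = u∈Tt X X-tight t∈X
    where
    open ℤP.≤-Reasoning
    k : ℤ
    k = (β - 1ℤ) * + ∣ X ∣

    𝟙[mt≡β]>0 : 0ℤ < 𝟙[ m t ≡ β ]
    𝟙[mt≡β]>0 = subst (0ℤ <_) (sym (𝟙-yes (m t ℤ.≟ β) mt≡β)) (ℤ.+<+ (ℕ.s≤s ℕ.z≤n))

    #β≤h₁X : #β ≤ a - k
    #β≤h₁X = subst (λ w → (a - k) ≥∞ w) h₁-S₁ (v-max S₁)

    X-tight : Tight p m X
    X-tight = ⇒tight (trans pX≡a (cong just (ℤP.≤-antisym (lower-bound pX≡a) (-ʳ-cancel-≤ k (begin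
      sum m X - k    ≡⟨ sum-shift m (β - 1ℤ) X ⟨
      sum excess X   ≤⟨ sum-excess≤#β X ⟩
      #β             ≤⟨ #β≤h₁X ⟩
      a - k          ∎)))))

    t∈X : t ∈ X
    t∈X = decidable-stable (t ∈? X) λ t∉X →
      ℤP.<⇒≱ (sum<sum⊤ (λ u → 0≤𝟙 (m u ℤ.≟ β)) X t∉X 𝟙[mt≡β]>0) (begin
        #β                            ≤⟨ #β≤h₁X ⟩
        a - k                         ≤⟨ h₁≤sum-excess pX≡a ⟩
        sum excess X                  ≤⟨ sum-mono-≤ X excess≤𝟙 ⟩
        sum (λ u → 𝟙[ m u ≡ β ]) X    ∎)

  S₁m⇔peakSet : ∀ u → InS1m p β m u ⇔ InPeakSet p β u
  S₁m⇔peakSet u = mk⇔ (λ u∈S₁m X X-max → maximizer⊇S₁m X-max u∈S₁m)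
                      (λ u∈peak → Equivalence.to ∈S₁⇔ (u∈peak S₁ S₁-maximizes))

-- Decreasing minimality implies pre-decreasing minimality

count : ℤ → List ℤ → ℕ
count β = length ∘ filter (ℤ._≟ β)

Descending : List ℤ → Set
Descending = AllPairs (λ a b → b ≤ a)

AllPairs-reverse⁺ : ∀ {A : Set} {R : A → A → Set} {xs} → AllPairs R xs → AllPairs (flip R) (reverse xs)
AllPairs-reverse⁺ {xs = []}     []                = []
AllPairs-reverse⁺ {R = R} {x ∷ xs} (x-R-xs ∷ R-xs) =
  subst (AllPairs (flip R)) (sym (unfold-reverse x xs)) (AllPairsP.++⁺ (AllPairs-reverse⁺ R-xs) ([] ∷ [])
                 (All.map (_∷ []) (All-resp-↭ (↭-sym (↭-reverse xs)) x-R-xs)))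

dec↓-descending : ∀ {n} (x : Fin n → ℤ) → Descending (dec↓ x)
dec↓-descending {n} x = AllPairs-reverse⁺ (Linked⇒AllPairs ℤP.≤-trans (sort-↗ (map x (allFin n))))

dec↓-↭ : ∀ {n} (x : Fin n → ℤ) → dec↓ x ↭ map x (allFin n)
dec↓-↭ {n} x = ↭-trans (↭-reverse _) (sort-↭ (map x (allFin n)))

count-dec↓ : ∀ {n} β (x : Fin n → ℤ) → count β (dec↓ x) ≡ countEq β x
count-dec↓ {n} β x =
  trans (↭-length (filter-↭ (ℤ._≟ β) (dec↓-↭ x))) (length-filter-map (ℤ._≟ β) x (allFin n))

covered⇒dec↓≤ : ∀ {n β} {x : Fin n → ℤ} → Covered β x → All (_≤ β) (dec↓ x)
covered⇒dec↓≤ {x = x} x≤β = All-resp-↭ (↭-sym (dec↓-↭ x)) (AllP.map⁺ (All.tabulate λ {s} _ → x≤β s))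

dec↓≤⇒covered : ∀ {n β} {x : Fin n → ℤ} → All (_≤ β) (dec↓ x) → Covered β x
dec↓≤⇒covered {x = x} dec↓≤β s = All.lookup (AllP.map⁻ (All-resp-↭ (dec↓-↭ x) dec↓≤β)) (∈-allFin s)

LexLe-covered : ∀ {β} xs ys → Descending xs → All (_≤ β) ys → LexLe xs ys →
  All (_≤ β) xs × count β xs ℕ.≤ count β ys
LexLe-covered []       []        _          _         _         = [] , ℕ.z≤n
LexLe-covered {β} (a ∷ as) (b ∷ bs) (as≤a ∷ _) (b≤β ∷ _) (inj₁ a<b) =
  All.map ℤP.<⇒≤ below-β ,
  subst (ℕ._≤ _) (sym (cong length (filter-none (ℤ._≟ β) (All.map ℤP.<⇒≢ below-β)))) ℕ.z≤n
  where
  a<β : a < β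
  a<β = ℤP.<-≤-trans a<b b≤β

  below-β : All (_< β) (a ∷ as)
  below-β = a<β ∷ All.map (λ x≤a → ℤP.≤-<-trans x≤a a<β) as≤a
LexLe-covered {β} (a ∷ as) (.a ∷ bs) (_ ∷ as↓) (a≤β ∷ bs≤β) (inj₂ (refl , as≤bs))
  with LexLe-covered as bs as↓ bs≤β as≤bs | a ℤ.≟ β
... | as≤β , count≤ | yes _ = a≤β ∷ as≤β , ℕ.s≤s count≤
... | as≤β , count≤ | no _  = a≤β ∷ as≤β , count≤

DecMin⇒PreDecMin : ∀ {n} {p : Subset n → ℤ∞} {β m} → IsBeta1 p β → DecMin p m → PreDecMin p β m
DecMin⇒PreDecMin {β = β} {m} ((z , z∈B , z≤β , _) , _) (m∈B , m-decmin) =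
  m∈B , dec↓≤⇒covered (proj₁ (compare (m-decmin z z∈B) z≤β)) ,
  λ y y∈B y≤β → subst₂ ℕ._≤_ (count-dec↓ β m) (count-dec↓ β y) (proj₂ (compare (m-decmin y y∈B) y≤β))
  where
  compare : ∀ {y} → LexLe (dec↓ m) (dec↓ y) → Covered β y →
            All (_≤ β) (dec↓ m) × count β (dec↓ m) ℕ.≤ count β (dec↓ y)
  compare {y} m≤y y≤β = LexLe-covered (dec↓ m) (dec↓ y) (dec↓-descending m) (covered⇒dec↓≤ y≤β) m≤y

-- Minimality of β₁ is used only to see that dec-min elements are β₁-covered.
theorem4p4 : (k : ℕ) (p : Subset (suc k) → ℤ∞) → Admissible p →
    (β₁ : ℤ) → IsBeta1 p β₁ →
    ((m : Fin (suc k) → ℤ) → PreDecMin p β₁ m →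
       (u : Fin (suc k)) → InS1m p β₁ m u ⇔ InPeakSet p β₁ u)
    × ((m : Fin (suc k) → ℤ) → DecMin p m →
       (u : Fin (suc k)) → InS1m p β₁ m u ⇔ InPeakSet p β₁ u)
theorem4p4 k p adm β₁ β₁-min =
  (λ m m-pre-dec-min → S₁m⇔peakSet adm m-pre-dec-min) ,
  (λ m m-dec-min → S₁m⇔peakSet adm (DecMin⇒PreDecMin β₁-min m-dec-min))
  where open PreDecMinimal using (S₁m⇔peakSet)
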